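{- Let $\varphi$ be a $\mathrm{D}$-formula and $A,A'$ be $\varphi$-atoms. Then $A\,D_\varphi\,A'$ if and only if $\mathcal{R}eq_D(A')\subseteq\mathcal{R}eq_D(A)$ and $\mathcal{O}bs_D(A')\subseteq\mathcal{R}eq_D(A)$.
   Context: Formulas: $\varphi ::= p\mid\neg\varphi\mid\varphi\vee\varphi\mid\langle D\rangle\varphi$, $p\in\mathcal{AP}$; $[D]\psi:=\neg\langle D\rangle\neg\psi$. $\mathrm{CL}(\varphi)$ is the set of subformulas of $\varphi$ and their negations, identifying $\neg\neg\psi$ with $\psi$ and $\neg\langle D\rangle\psi$ with $[D]\neg\psi$. A $\varphi$-atom is $A\subseteq\mathrm{CL}(\varphi)$ such that for every $\psi\in\mathrm{CL}(\varphi)$, $\psi\in A$ iff $\neg\psi\notin A$, and for every $\psi_1\vee\psi_2\in\mathrm{CL}(\varphi)$, $\psi_1\vee\psi_2\in A$ iff $\psi_1\in A$ or $\psi_2\in A$. $\mathcal{R}eq_D(A)=\{\psi:\langle D\rangle\psi\in A\}$, $\mathrm{REQ}_\varphi=\{\psi:\langle D\rangle\psi\in\mathrm{CL}(\varphi)\}$, $\mathcal{O}bs_D(A)=\{\psi\in A:\psi\in\mathrm{REQ}_\varphi\}$. $A\,D_\varphi\,A'$ holds iff for every formula $[D]\psi\in A$, both $\psi\in A'$ and $[D]\psi\in A'$. -}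

module Defs where

open import Data.Product using (Σ; _×_; _,_)
open import Data.Sum using (_⊎_)
open import Relation.Nullary using (¬_)
open import Relation.Binary.PropositionalEquality using (_≡_)
open import Function.Bundles using (_⇔_)

data Form (AP : Set) : Set where
  var  : AP → Form AP
  ~_   : Form AP → Form AP
  _∨_  : Form AP → Form AP → Form AP
  ⟨D⟩_ : Form AP → Form AP

infixr 8 ~_ ⟨D⟩_
infixl 6 _∨_

module _ {AP : Set} where

  -- Negation modulo the identification ¬¬ψ = ψ.
  neg : Form AP → Form AP
  neg (~ ψ) = ψ
  neg (var p) = ~ var p
  neg (ψ ∨ χ) = ~ (ψ ∨ χ)
  neg (⟨D⟩ ψ) = ~ ⟨D⟩ ψ

  -- Canonical representative: removes all double negations.
  -- (Under this, ¬⟨D⟩ψ and [D]¬ψ have the same representative.)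
  norm : Form AP → Form AP
  norm (var p) = var p
  norm (~ ψ) = neg (norm ψ)
  norm (ψ ∨ χ) = norm ψ ∨ norm χ
  norm (⟨D⟩ ψ) = ⟨D⟩ norm ψ

  -- [D]ψ := ¬⟨D⟩¬ψ  (canonical representative, for ψ canonical)
  [D]_ : Form AP → Form AP
  [D] ψ = ~ ⟨D⟩ (neg ψ)

  data Sub : Form AP → Form AP → Set where
    here  : ∀ {φ} → Sub φ φ
    neg-s : ∀ {ψ φ} → Sub ψ φ → Sub ψ (~ φ)
    orˡ   : ∀ {ψ φ₁ φ₂} → Sub ψ φ₁ → Sub ψ (φ₁ ∨ φ₂)
    orʳ   : ∀ {ψ φ₁ φ₂} → Sub ψ φ₂ → Sub ψ (φ₁ ∨ φ₂)
    dia   : ∀ {ψ φ} → Sub ψ φ → Sub ψ (⟨D⟩ φ)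

  -- CL(φ): subformulas of φ and their negations, modulo the identifications
  -- (elements are canonical representatives).
  CL : Form AP → Form AP → Set
  CL φ χ = Σ (Form AP) λ ψ → Sub ψ φ × (χ ≡ norm ψ ⊎ χ ≡ neg (norm ψ))

  -- φ-atoms: subsets A ⊆ CL(φ) that are maximally consistent.
  record Atom (φ : Form AP) : Set₁ where
    field
      mem   : Form AP → Set
      ⊆CL   : ∀ ψ → mem ψ → CL φ ψ
      compl : ∀ ψ → CL φ ψ → (mem ψ ⇔ (¬ mem (neg ψ)))
      disj  : ∀ ψ₁ ψ₂ → CL φ (ψ₁ ∨ ψ₂) → (mem (ψ₁ ∨ ψ₂) ⇔ (mem ψ₁ ⊎ mem ψ₂))
  open Atom public

  _∈A_ : ∀ {φ} → Form AP → Atom φ → Set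
  ψ ∈A A = mem A ψ

  _⊆_ : (Form AP → Set) → (Form AP → Set) → Set
  P ⊆ Q = ∀ ψ → P ψ → Q ψ

  Req : ∀ {φ} → Atom φ → Form AP → Set
  Req A ψ = (⟨D⟩ ψ) ∈A A

  REQ : Form AP → Form AP → Set
  REQ φ ψ = CL φ (⟨D⟩ ψ)

  Obs : ∀ {φ} → Atom φ → Form AP → Set
  Obs {φ} A ψ = (ψ ∈A A) × REQ φ ψ

  Dφ : ∀ {φ} → Atom φ → Atom φ → Set
  Dφ {φ} A A' = ∀ ψ → CL φ ψ → ([D] ψ) ∈A A → (ψ ∈A A') × (([D] ψ) ∈A A')

-- Membership in an atom is decided on the closure: for χ ∈ CL(φ), χ ∉ A iff
-- neg χ ∈ A.  For a closure formula ψ, [D](neg ψ) is ¬⟨D⟩ψ, so A D_φ A' says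
-- exactly that ¬⟨D⟩ψ ∈ A forces both neg ψ ∈ A' and ¬⟨D⟩ψ ∈ A'.  Contraposing
-- the second half gives Req_D(A') ⊆ Req_D(A), contraposing the first half gives
-- Obs_D(A') ⊆ Req_D(A), and conversely.
module Submission where

open import Defs
open import Data.Product using (Σ; _×_; _,_; proj₁; proj₂)
open import Data.Sum using (_⊎_; inj₁; inj₂; swap; map)
open import Relation.Nullary using (¬_)
open import Function.Bundles using (_⇔_; mk⇔; Equivalence)
open import Relation.Binary.PropositionalEquality using (_≡_; refl; sym; trans; cong; subst)

module _ {AP : Set} where

  neg-involutive-norm : (χ : Form AP) → neg (neg (norm χ)) ≡ norm χ
  neg-involutive-norm (var p) = refl
  neg-involutive-norm (~ χ)   = cong neg (neg-involutive-norm χ)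
  neg-involutive-norm (χ ∨ θ) = refl
  neg-involutive-norm (⟨D⟩ χ) = refl

  norm-~⇒ : ∀ (χ : Form AP) {θ} → norm (~ χ) ≡ θ → norm χ ≡ neg θ
  norm-~⇒ χ e = trans (sym (neg-involutive-norm χ)) (cong neg e)

  ≡±norm⇒norm≡± : ∀ (χ : Form AP) {ξ} → ξ ≡ norm χ ⊎ ξ ≡ neg (norm χ) →
                  norm χ ≡ ξ ⊎ norm χ ≡ neg ξ
  ≡±norm⇒norm≡± χ (inj₁ e) = inj₁ (sym e)
  ≡±norm⇒norm≡± χ (inj₂ e) = inj₂ (norm-~⇒ χ (sym e))

  Sub-trans : {χ θ ξ : Form AP} → Sub χ θ → Sub θ ξ → Sub χ ξ
  Sub-trans s here      = s
  Sub-trans s (neg-s t) = neg-s (Sub-trans s t)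
  Sub-trans s (orˡ t)   = orˡ (Sub-trans s t)
  Sub-trans s (orʳ t)   = orʳ (Sub-trans s t)
  Sub-trans s (dia t)   = dia (Sub-trans s t)

  norm≡±⟨D⟩⇒Sub : ∀ (χ : Form AP) {ψ} → norm χ ≡ ⟨D⟩ ψ ⊎ norm χ ≡ ~ ⟨D⟩ ψ →
                  Σ (Form AP) λ θ → Sub θ χ × (ψ ≡ norm θ)
  norm≡±⟨D⟩⇒Sub (var p) (inj₁ ())
  norm≡±⟨D⟩⇒Sub (var p) (inj₂ ())
  norm≡±⟨D⟩⇒Sub (χ ∨ θ) (inj₁ ())
  norm≡±⟨D⟩⇒Sub (χ ∨ θ) (inj₂ ())
  norm≡±⟨D⟩⇒Sub (⟨D⟩ χ) (inj₁ refl) = χ , dia here , refl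
  norm≡±⟨D⟩⇒Sub (⟨D⟩ χ) (inj₂ ())
  norm≡±⟨D⟩⇒Sub (~ χ) e with θ , s , ψ≡ ← norm≡±⟨D⟩⇒Sub χ (swap (map (norm-~⇒ χ) (norm-~⇒ χ) e))
    = θ , neg-s s , ψ≡

  module _ {φ : Form AP} where

    CL-neg : ∀ {χ} → CL φ χ → CL φ (neg χ)
    CL-neg (θ , s , inj₁ refl) = θ , s , inj₂ refl
    CL-neg (θ , s , inj₂ refl) = θ , s , inj₁ (neg-involutive-norm θ)

    CL-neg-involutive : ∀ {χ} → CL φ χ → neg (neg χ) ≡ χ
    CL-neg-involutive (θ , s , inj₁ refl) = neg-involutive-norm θ
    CL-neg-involutive (θ , s , inj₂ refl) = cong neg (neg-involutive-norm θ)

    CL-⟨D⟩⁻ : ∀ {ψ} → CL φ (⟨D⟩ ψ) → CL φ ψ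
    CL-⟨D⟩⁻ (χ , s , e) with θ , t , refl ← norm≡±⟨D⟩⇒Sub χ (≡±norm⇒norm≡± χ e)
      = θ , Sub-trans t s , inj₁ refl

    [D]-neg : ∀ {ψ} → CL φ ψ → [D] (neg ψ) ≡ ~ ⟨D⟩ ψ
    [D]-neg c = cong (λ χ → ~ ⟨D⟩ χ) (CL-neg-involutive c)

    module _ (A : Atom φ) where

      ∈⇒neg∉ : ∀ {χ} → χ ∈A A → ¬ neg χ ∈A A
      ∈⇒neg∉ {χ} m = Equivalence.to (compl A χ (⊆CL A χ m)) m

      neg∉⇒∈ : ∀ {χ} → CL φ χ → ¬ neg χ ∈A A → χ ∈A A
      neg∉⇒∈ {χ} c = Equivalence.from (compl A χ c)

    module _ (A A' : Atom φ) where

      Dφ-~⟨D⟩ : Dφ A A' → ∀ {ψ} → CL φ (⟨D⟩ ψ) → (~ ⟨D⟩ ψ) ∈A A →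
                (neg ψ ∈A A') × ((~ ⟨D⟩ ψ) ∈A A')
      Dφ-~⟨D⟩ d {ψ} c = subst (λ χ → χ ∈A A → neg ψ ∈A A' × χ ∈A A')
                              ([D]-neg (CL-⟨D⟩⁻ c)) (d (neg ψ) (CL-neg (CL-⟨D⟩⁻ c)))

      Dφ⇒Req⊆Req : Dφ A A' → Req A' ⊆ Req A
      Dφ⇒Req⊆Req d ψ m' = neg∉⇒∈ A c λ m → ∈⇒neg∉ A' m' (proj₂ (Dφ-~⟨D⟩ d c m))
        where
        c : CL φ (⟨D⟩ ψ)
        c = ⊆CL A' (⟨D⟩ ψ) m'

      Dφ⇒Obs⊆Req : Dφ A A' → Obs A' ⊆ Req A
      Dφ⇒Obs⊆Req d ψ (m' , c) = neg∉⇒∈ A c λ m → ∈⇒neg∉ A' m' (proj₁ (Dφ-~⟨D⟩ d c m))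

      ⊆Req⇒Dφ : Req A' ⊆ Req A → Obs A' ⊆ Req A → Dφ A A'
      ⊆Req⇒Dφ req obs ψ c m =
          neg∉⇒∈ A' c (λ n → ∈⇒neg∉ A m (obs (neg ψ) (n , ⟨D⟩negψ∈CL)))
        , neg∉⇒∈ A' (⊆CL A ([D] ψ) m) (λ n → ∈⇒neg∉ A m (req (neg ψ) n))
        where
        ⟨D⟩negψ∈CL : CL φ (⟨D⟩ neg ψ)
        ⟨D⟩negψ∈CL = CL-neg (⊆CL A ([D] ψ) m)

proposition2p5 : {AP : Set} (φ : Form AP) (A A' : Atom φ) →
    Dφ A A' ⇔ ((Req A' ⊆ Req A) × (Obs A' ⊆ Req A))
proposition2p5 φ A A' =
  mk⇔ (λ d → Dφ⇒Req⊆Req A A' d , Dφ⇒Obs⊆Req A A' d)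
      (λ (req , obs) → ⊆Req⇒Dφ A A' req obs)
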